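{- Let $\{h_1,\ldots,h_k\}$ be an admissible $k$-tuple, let $S$ be a set of integers, and let $\mathscr{P}$ be a set of primes, such that for some $x\ge2$, \[\{h_1,\ldots,h_k\}\subseteq S\subseteq[0,x^2]\qquad\text{and}\qquad |\{p\in\mathscr{P}:p>x\}|>|S|+k.\] Then there is a set of integers $\{a_p:p\in\mathscr{P}\}$ such that \[\{h_1,\ldots,h_k\}=S\setminus\bigcup_{p\in\mathscr{P}}\{g:g\equiv a_p\bmod p\}.\]
   Context: A $k$-tuple of integers $\{h_1,\ldots,h_k\}$ is admissible if for every prime $p$, the number of residue classes $n\bmod p$ with $\prod_{i=1}^k(n+h_i)\equiv0\bmod p$ is less than $p$.
   Formalization: The parameter x ranges over the rationals. -}

module Defs where

open import Data.Nat as ℕ using (ℕ; _<_)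
open import Data.Nat.Primality using (Prime)
open import Data.Integer as ℤ using (ℤ; +_)
open import Data.Integer.Divisibility.Signed using (_∣_; _∣?_)
open import Data.List using (List; length; filter; upTo)
open import Data.Vec as Vec using (Vec)
open import Data.Rational as ℚ using (ℚ)

prodℤ : ∀ {k} → Vec ℤ k → ℤ
prodℤ = Vec.foldr _ ℤ._*_ (ℤ.+ 1)

shiftProd : ∀ {k} → Vec ℤ k → ℤ → ℤ
shiftProd h n = prodℤ (Vec.map (λ hᵢ → n ℤ.+ hᵢ) h)

coveredClasses : ∀ {k} → Vec ℤ k → ℕ → ℕ
coveredClasses h p =
  length (filter (λ n → (+ p) ∣? shiftProd h (+ n)) (upTo p))

Admissible : ∀ {k} → Vec ℤ k → Set
Admissible h = ∀ p → Prime p → coveredClasses h p < p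

_≡_[mod_] : ℤ → ℤ → ℕ → Set
g ≡ a [mod p ] = (+ p) ∣ (g ℤ.- a)

toℚ : ℤ → ℚ
toℚ z = z ℚ./ 1

-- Call a prime large if it exceeds x. Since all elements of S lie in [0, x²], a nonzero difference
-- y − s of two of them has absolute value at most x², while two distinct large primes have product
-- greater than x²; so at most one large prime divides y − s. Hence for each s ∈ S outside the tuple
-- at most k large primes divide some hᵢ − s, and, processing S one element at a time, there is
-- always an unused large prime p_s for which the class a_p = s contains no hᵢ. Every other prime p
-- gets a class missing the tuple, which exists by admissibility.

module Submission where

open import Defs
open import Data.Nat as ℕ using (ℕ)
open import Data.Nat.Primality using (Prime)
open import Data.Integer as ℤ using (ℤ; +_)
open import Data.Rational as ℚ using (ℚ)
open import Data.List using (List; length)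
open import Data.List.Membership.Propositional using (_∈_)
open import Data.List.Relation.Unary.All using (All)
open import Data.List.Relation.Unary.Unique.Propositional using (Unique)
open import Data.Vec as Vec using (Vec)
open import Data.Vec.Membership.Propositional as VecMem using ()
open import Data.Product using (Σ; _×_)
open import Relation.Nullary using (¬_)
open import Function.Bundles using (_⇔_)

open import Data.Nat.Primality using (euclidsLemma; prime⇒irreducible; ¬prime[1])
import Data.Nat.Divisibility as ℕ
import Data.Nat.Properties as ℕ
import Data.Integer.Properties as ℤ
open import Data.Integer.GCD using (gcd; gcd-zeroʳ)
open import Data.Integer.Divisibility.Signed
  using (_∣_; _∣?_; ∣⇒∣ᵤ; ∣ᵤ⇒∣; ∣-trans; ∣-refl; ∣m⇒∣m*n; ∣n⇒∣m*n)
open import Data.Rational using (↥_; ↧_; ↧ₙ_)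
import Data.Rational.Properties as ℚ
open import Data.List using ([]; _∷_; filter; map; upTo)
open import Data.List.Properties using (filter-all; length-upTo)
open import Data.List.Relation.Unary.Any using (here; there; satisfied)
import Data.List.Relation.Unary.All as All
import Data.List.Relation.Unary.All.Properties as All
import Data.List.Relation.Unary.Unique.Propositional.Properties as Unique
open import Data.List.Relation.Unary.AllPairs using (_∷_; [])
open import Data.List.Membership.Propositional.Properties using (∈-filter⁻; ∈-map⁺)
open import Data.Vec.Relation.Unary.Any as VecAny using ()
open import Data.Vec.Membership.Propositional.Properties using (∈-toList⁺; ∈-toList⁻)
open import Data.Vec.Membership.DecPropositional ℤ._≟_ using () renaming (_∈?_ to _∈ᵥ?_)
open import Data.Vec.Properties using (length-toList)
open import Data.Product using (_,_; proj₁; proj₂; uncurry)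
open import Data.Sum using (inj₁; inj₂)
open import Data.Empty using (⊥-elim)
open import Function.Base using (_∘_)
open import Function.Bundles using (mk⇔)
open import Relation.Nullary using (yes; no; ¬?; contradiction)
open import Relation.Unary using (Decidable)
open import Relation.Binary.PropositionalEquality

open VecMem using () renaming (_∈_ to _∈ᵥ_)

toℚ-numerator : ∀ z → ↥ toℚ z ≡ z
toℚ-numerator z = begin
  ↥ toℚ z                  ≡⟨ ℤ.*-identityʳ _ ⟨
  ↥ toℚ z ℤ.* ℤ.1ℤ         ≡⟨ cong (↥ toℚ z ℤ.*_) (gcd-zeroʳ z) ⟨
  ↥ toℚ z ℤ.* gcd z ℤ.1ℤ   ≡⟨ ℚ.↥-/ z 1 ⟩
  z                        ∎
  where open ≡-Reasoning

toℚ-denominator : ∀ z → ↧ₙ toℚ z ≡ 1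
toℚ-denominator z = ℤ.+-injective (begin
  ↧ toℚ z                  ≡⟨ ℤ.*-identityʳ _ ⟨
  ↧ toℚ z ℤ.* ℤ.1ℤ         ≡⟨ cong (↧ toℚ z ℤ.*_) (gcd-zeroʳ z) ⟨
  ↧ toℚ z ℤ.* gcd z ℤ.1ℤ   ≡⟨ ℚ.↧-/ z 1 ⟩
  ℤ.1ℤ                     ∎)
  where open ≡-Reasoning

*-unnormalised : ∀ p q → p ℚ.* q ≡ (↥ p ℤ.* ↥ q) ℚ./ (↧ₙ p ℕ.* ↧ₙ q)
*-unnormalised (ℚ.mkℚ _ _ _) (ℚ.mkℚ _ _ _) = refl

toℚ-* : ∀ a b → toℚ a ℚ.* toℚ b ≡ toℚ (a ℤ.* b)
toℚ-* a b = trans (*-unnormalised (toℚ a) (toℚ b))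
  (ℚ./-cong (cong₂ ℤ._*_ (toℚ-numerator a) (toℚ-numerator b))
            (cong₂ ℕ._*_ (toℚ-denominator a) (toℚ-denominator b)))

toℚ-cross : ∀ a b → ↥ toℚ a ℤ.* ↧ toℚ b ≡ a
toℚ-cross a b =
  trans (cong₂ ℤ._*_ (toℚ-numerator a) (cong +_ (toℚ-denominator b))) (ℤ.*-identityʳ a)

toℚ-mono-≤ : ∀ {a b} → a ℤ.≤ b → toℚ a ℚ.≤ toℚ b
toℚ-mono-≤ {a} {b} a≤b =
  ℚ.*≤* (subst₂ ℤ._≤_ (sym (toℚ-cross a b)) (sym (toℚ-cross b a)) a≤b)

toℚ-cancel-≤ : ∀ {a b} → toℚ a ℚ.≤ toℚ b → a ℤ.≤ b
toℚ-cancel-≤ {a} {b} (ℚ.*≤* le) = subst₂ ℤ._≤_ (toℚ-cross a b) (toℚ-cross b a) le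

square<* : ∀ {x p q} → ℚ.0ℚ ℚ.≤ x → x ℚ.< p → x ℚ.< q → x ℚ.* x ℚ.< p ℚ.* q
square<* {x} {p} {q} 0≤x x<p x<q = begin-strict
  x ℚ.* x   ≤⟨ ℚ.*-monoˡ-≤-nonNeg x {{ℚ.nonNegative 0≤x}} (ℚ.<⇒≤ x<q) ⟩
  x ℚ.* q   <⟨ ℚ.*-monoˡ-<-pos q {{ℚ.positive (ℚ.≤-<-trans 0≤x x<q)}} x<p ⟩
  p ℚ.* q   ∎
  where open ℚ.≤-Reasoning

*-∣-of-distinct-primes : ∀ {p q d} → Prime p → Prime q → p ≢ q →
                         p ℕ.∣ d → q ℕ.∣ d → q ℕ.* p ℕ.∣ d
*-∣-of-distinct-primes {p} {q} p-prime q-prime p≢q (ℕ.divides c refl) q∣cp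
  with euclidsLemma c p q-prime q∣cp
... | inj₁ q∣c = ℕ.*-pres-∣ q∣c ℕ.∣-refl
... | inj₂ q∣p with prime⇒irreducible p-prime q∣p
...   | inj₁ refl = ⊥-elim (¬prime[1] q-prime)
...   | inj₂ refl = contradiction refl p≢q

_∈[0,_²] : ℤ → ℚ → Set
s ∈[0, x ²] = (ℚ.0ℚ ℚ.≤ toℚ s) × (toℚ s ℚ.≤ x ℚ.* x)

LargePrime : ℚ → ℕ → Set
LargePrime x p = Prime p × x ℚ.< toℚ (+ p)

∣-∣≤square : ∀ {x y s} → y ∈[0, x ²] → s ∈[0, x ²] → toℚ (+ ℤ.∣ y ℤ.- s ∣) ℚ.≤ x ℚ.* x
∣-∣≤square {x} {+ m} {+ n} (_ , m≤x²) (_ , n≤x²) =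
  ℚ.≤-trans (toℚ-mono-≤ (ℤ.+≤+ ∣m-n∣≤m⊔n)) m⊔n≤x²
  where
  ∣m-n∣≤m⊔n : ℤ.∣ + m ℤ.- + n ∣ ℕ.≤ m ℕ.⊔ n
  ∣m-n∣≤m⊔n = subst (ℕ._≤ m ℕ.⊔ n) (cong ℤ.∣_∣ (sym (ℤ.m-n≡m⊖n m n))) (ℤ.∣m⊝n∣≤m⊔n m n)
  m⊔n≤x² : toℚ (+ (m ℕ.⊔ n)) ℚ.≤ x ℚ.* x
  m⊔n≤x² with ℕ.⊔-sel m n
  ... | inj₁ m⊔n≡m rewrite m⊔n≡m = m≤x²
  ... | inj₂ m⊔n≡n rewrite m⊔n≡n = n≤x²
∣-∣≤square {y = y@(ℤ.-[1+ _ ])} (0≤y , _) _ =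
  contradiction (toℚ-cancel-≤ {+ 0} {y} 0≤y) λ ()
∣-∣≤square {y = + _} {s@(ℤ.-[1+ _ ])} _ (0≤s , _) =
  contradiction (toℚ-cancel-≤ {+ 0} {s} 0≤s) λ ()

large-prime-divisor-unique : ∀ {x y s p q} → ℚ.0ℚ ℚ.≤ x → y ∈[0, x ²] → s ∈[0, x ²] → y ≢ s →
  LargePrime x p → LargePrime x q → y ≡ s [mod p ] → y ≡ s [mod q ] → p ≡ q
large-prime-divisor-unique {x} {y} {s} {p} {q}
  0≤x y-range s-range y≢s (p-prime , x<p) (q-prime , x<q) p∣y-s q∣y-s with p ℕ.≟ q
... | yes p≡q = p≡q
... | no p≢q = contradiction (ℚ.<-≤-trans x²<qp qp≤x²) (ℚ.<-irrefl refl)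
  where
  ∣y-s∣≢0 : ℕ.NonZero ℤ.∣ y ℤ.- s ∣
  ∣y-s∣≢0 = ℕ.≢-nonZero (y≢s ∘ ℤ.i-j≡0⇒i≡j y s ∘ ℤ.∣i∣≡0⇒i≡0)
  qp≤∣y-s∣ : q ℕ.* p ℕ.≤ ℤ.∣ y ℤ.- s ∣
  qp≤∣y-s∣ = ℕ.∣⇒≤ {{∣y-s∣≢0}}
    (*-∣-of-distinct-primes p-prime q-prime p≢q (∣⇒∣ᵤ p∣y-s) (∣⇒∣ᵤ q∣y-s))
  qp≤x² : toℚ (+ (q ℕ.* p)) ℚ.≤ x ℚ.* x
  qp≤x² = ℚ.≤-trans (toℚ-mono-≤ (ℤ.+≤+ qp≤∣y-s∣)) (∣-∣≤square {x} {y} {s} y-range s-range)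
  x²<qp : x ℚ.* x ℚ.< toℚ (+ (q ℕ.* p))
  x²<qp = subst (x ℚ.* x ℚ.<_) (trans (toℚ-* (+ q) (+ p)) (cong toℚ (sym (ℤ.pos-* q p))))
                (square<* 0≤x x<q x<p)

AtMostOneIn : {A : Set} → List A → (A → Set) → Set
AtMostOneIn xs P = ∀ {a b} → a ∈ xs → b ∈ xs → P a → P b → a ≡ b

module _ {A : Set} {P : A → Set} (P? : Decidable P) where

  length≤1+length-filter-¬ : ∀ {xs} → Unique xs → AtMostOneIn xs P →
                             length xs ℕ.≤ ℕ.suc (length (filter (¬? ∘ P?) xs))
  length≤1+length-filter-¬ {[]} _ _ = ℕ.z≤n
  length≤1+length-filter-¬ {a ∷ xs} (a∉xs ∷ xs-unique) at-most-one with P? a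
  ... | yes Pa = ℕ.s≤s (ℕ.≤-reflexive (sym (cong length (filter-all (¬? ∘ P?) others-fail))))
    where
    others-fail : All (¬_ ∘ P) xs
    others-fail = All.tabulate λ b∈xs Pb →
      All.lookup a∉xs b∈xs (at-most-one (here refl) (there b∈xs) Pa Pb)
  ... | no _ = ℕ.s≤s (length≤1+length-filter-¬ xs-unique
                        λ a∈ b∈ → at-most-one (there a∈) (there b∈))

module _ {A Y : Set} (Q : Y → A → Set) (Q? : ∀ y → Decidable (Q y)) where

  ∃-avoiding-all : ∀ ys {xs} → Unique xs → (∀ {y} → y ∈ ys → AtMostOneIn xs (Q y)) →
                   length ys ℕ.< length xs → Σ A λ a → a ∈ xs × (∀ {y} → y ∈ ys → ¬ Q y a)
  ∃-avoiding-all [] {a ∷ _} _ _ _ = a , here refl , λ ()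
  ∃-avoiding-all (y ∷ ys) {xs} xs-unique at-most-one ys<xs =
    extend (∃-avoiding-all ys (Unique.filter⁺ F xs-unique) at-most-one-left ys<left)
    where
    F = ¬? ∘ Q? y
    ∈-left⁻ : ∀ {a} → a ∈ filter F xs → a ∈ xs × ¬ Q y a
    ∈-left⁻ = ∈-filter⁻ F {xs = xs}
    at-most-one-left : ∀ {y′} → y′ ∈ ys → AtMostOneIn (filter F xs) (Q y′)
    at-most-one-left y′∈ a∈ b∈ = at-most-one (there y′∈) (proj₁ (∈-left⁻ a∈)) (proj₁ (∈-left⁻ b∈))
    ys<left : length ys ℕ.< length (filter F xs)
    ys<left = ℕ.≤-pred (ℕ.≤-trans ys<xs
      (length≤1+length-filter-¬ (Q? y) xs-unique (at-most-one (here refl))))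
    extend : Σ A (λ a → a ∈ filter F xs × (∀ {y′} → y′ ∈ ys → ¬ Q y′ a)) →
             Σ A (λ a → a ∈ xs × (∀ {y′} → y′ ∈ y ∷ ys → ¬ Q y′ a))
    extend (a , a∈ , avoids) =
      a , proj₁ (∈-left⁻ a∈) , λ { (here refl) → proj₂ (∈-left⁻ a∈) ; (there y′∈) → avoids y′∈ }

without : ℕ → List ℕ → List ℕ
without p = filter (λ q → ¬? (q ℕ.≟ p))

∈-without⁻ : ∀ {p q} L → q ∈ without p L → q ∈ L × q ≢ p
∈-without⁻ {p} L = ∈-filter⁻ (λ q → ¬? (q ℕ.≟ p)) {xs = L}

length≤1+length-without : ∀ p {L} → Unique L → length L ℕ.≤ ℕ.suc (length (without p L))
length≤1+length-without p L-unique =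
  length≤1+length-filter-¬ (ℕ._≟ p) L-unique λ _ _ a≡p b≡p → trans a≡p (sym b≡p)

Misses : ∀ {k} → Vec ℤ k → ℕ → ℤ → Set
Misses h p a = ∀ {y} → y ∈ᵥ h → ¬ (y ≡ a [mod p ])

∣-shiftProd : ∀ {k} (h : Vec ℤ k) n {y} → y ∈ᵥ h → (n ℤ.+ y) ∣ shiftProd h n
∣-shiftProd (y Vec.∷ _) n (VecAny.here refl) = ∣m⇒∣m*n _ ∣-refl
∣-shiftProd (z Vec.∷ h) n (VecAny.there y∈h) = ∣n⇒∣m*n (n ℤ.+ z) (∣-shiftProd h n y∈h)

admissible⇒missed-class : ∀ {k} (h : Vec ℤ k) {p} → Admissible h → Prime p → Σ ℤ (Misses h p)
admissible⇒missed-class h {p} admissible p-prime =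
  missed (satisfied (All.¬All⇒Any¬ divides? (upTo p) not-all-covered))
  where
  divides? : Decidable (λ n → + p ∣ shiftProd h (+ n))
  divides? n = + p ∣? shiftProd h (+ n)
  not-all-covered : ¬ All (λ n → + p ∣ shiftProd h (+ n)) (upTo p)
  not-all-covered all-covered = ℕ.<-irrefl
    (trans (cong length (filter-all divides? all-covered)) (length-upTo p)) (admissible p p-prime)
  missed : Σ ℕ (λ n → ¬ + p ∣ shiftProd h (+ n)) → Σ ℤ (Misses h p)
  missed (n , p∤) = ℤ.- + n , λ {y} y∈h p∣ →
    p∤ (∣-trans (subst (+ p ∣_) (shift y) p∣) (∣-shiftProd h (+ n) y∈h))
    where
    shift : ∀ y → y ℤ.- ℤ.- + n ≡ + n ℤ.+ y
    shift y = trans (cong (ℤ._+_ y) (ℤ.neg-involutive (+ n))) (ℤ.+-comm y (+ n))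

≡-refl[mod] : ∀ g p → g ≡ g [mod p ]
≡-refl[mod] g p = subst (+ p ∣_) (sym (ℤ.+-inverseʳ g)) (∣ᵤ⇒∣ (p ℕ.∣0))

module _ {V : Set} where

  lookupOr : List (ℕ × V) → ℕ → V → V
  lookupOr [] p d = d
  lookupOr ((q , v) ∷ t) p d with p ℕ.≟ q
  ... | yes _ = v
  ... | no _ = lookupOr t p d

  lookupOr-preserves : (Q : ℕ → V → Set) → ∀ t p d → Q p d → All (uncurry Q) t →
                       Q p (lookupOr t p d)
  lookupOr-preserves Q [] p d Qd _ = Qd
  lookupOr-preserves Q ((q , v) ∷ t) p d Qd (Qv All.∷ Qt) with p ℕ.≟ q
  ... | yes refl = Qv
  ... | no _ = lookupOr-preserves Q t p d Qd Qt

  lookupOr-∈ : ∀ t {p v} d → Unique (map proj₁ t) → (p , v) ∈ t → lookupOr t p d ≡ v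
  lookupOr-∈ ((q , w) ∷ t) {p} d (q∉t ∷ t-unique) pv∈ with p ℕ.≟ q | pv∈
  ... | yes _    | here refl = refl
  ... | yes refl | there pv∈t = contradiction refl (All.lookup q∉t (∈-map⁺ proj₁ pv∈t))
  ... | no p≢q   | here refl = contradiction refl p≢q
  ... | no _     | there pv∈t = lookupOr-∈ t d t-unique pv∈t

module LargePrimeAssignment {k} (h : Vec ℤ k) {x : ℚ} (0≤x : ℚ.0ℚ ℚ.≤ x)
                            (h-range : ∀ {y} → y ∈ᵥ h → y ∈[0, x ²]) where

  large-prime-missing : ∀ {s L} → s ∈[0, x ²] → ¬ s ∈ᵥ h → Unique L → All (LargePrime x) L →
                        k ℕ.< length L → Σ ℕ λ p → p ∈ L × Misses h p s
  large-prime-missing {s} {L} s-range s∉h L-unique L-large k<L = from-list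
    (∃-avoiding-all (λ y p → y ≡ s [mod p ]) (λ y p → + p ∣? (y ℤ.- s)) (Vec.toList h)
                    L-unique at-most-one (subst (ℕ._< length L) (sym (length-toList h)) k<L))
    where
    at-most-one : ∀ {y} → y ∈ Vec.toList h → AtMostOneIn L (λ p → y ≡ s [mod p ])
    at-most-one {y} y∈h p∈L q∈L =
      large-prime-divisor-unique {y = y} {s} 0≤x (h-range (∈-toList⁻ y∈h)) s-range
        (λ { refl → s∉h (∈-toList⁻ y∈h) }) (All.lookup L-large p∈L) (All.lookup L-large q∈L)
    from-list : Σ ℕ (λ p → p ∈ L × (∀ {y} → y ∈ Vec.toList h → ¬ y ≡ s [mod p ])) →
                Σ ℕ (λ p → p ∈ L × Misses h p s)
    from-list (p , p∈L , misses) = p , p∈L , misses ∘ ∈-toList⁺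

  record Assignment (T : List ℤ) (L : List ℕ) : Set where
    field
      pairs           : List (ℕ × ℤ)
      primes-distinct : Unique (map proj₁ pairs)
      pairs-valid     : All (uncurry λ p s → p ∈ L × Misses h p s) pairs
      covers          : ∀ {g} → g ∈ T → ¬ g ∈ᵥ h → Σ ℕ λ p → (p , g) ∈ pairs
  open Assignment

  assign-skip : ∀ {s T L} → s ∈ᵥ h → Assignment T L → Assignment (s ∷ T) L
  assign-skip s∈h A = record
    { pairs           = pairs A
    ; primes-distinct = primes-distinct A
    ; pairs-valid     = pairs-valid A
    ; covers          = λ { (here refl) s∉h → contradiction s∈h s∉h ; (there g∈T) → covers A g∈T }
    }

  assign-extend : ∀ {s T L p} → p ∈ L → Misses h p s →
                  Assignment T (without p L) → Assignment (s ∷ T) L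
  assign-extend {s} {L = L} {p} p∈L p-misses A = record
    { pairs           = (p , s) ∷ pairs A
    ; primes-distinct = All.map⁺ (All.map (λ (q∈ , _) → ≢-sym (proj₂ (∈-without⁻ L q∈))) (pairs-valid A))
                        ∷ primes-distinct A
    ; pairs-valid     = (p∈L , p-misses)
                        All.∷ All.map (λ (q∈ , misses) → proj₁ (∈-without⁻ L q∈) , λ {y} → misses {y})
                                      (pairs-valid A)
    ; covers          = λ { (here refl) _ → p , here refl
                          ; (there g∈T) g∉h → let q , qg∈ = covers A g∈T g∉h in q , there qg∈ }
    }

  assign : ∀ T L → Unique L → All (LargePrime x) L → All (_∈[0, x ²]) T →
           length T ℕ.+ k ℕ.< length L → Assignment T L
  assign [] _ _ _ _ _ =
    record { pairs = [] ; primes-distinct = [] ; pairs-valid = All.[] ; covers = λ () }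
  assign (s ∷ T) L L-unique L-large (s-range All.∷ T-range) T<L with s ∈ᵥ? h
  ... | yes s∈h =
    assign-skip s∈h (assign T L L-unique L-large T-range (ℕ.<-trans (ℕ.n<1+n _) T<L))
  ... | no s∉h with p , p∈L , p-misses ← large-prime-missing s-range s∉h L-unique L-large
                                           (ℕ.≤-<-trans (ℕ.m≤n+m k (ℕ.suc (length T))) T<L)
    = assign-extend p∈L p-misses
        (assign T (without p L) (Unique.filter⁺ _ L-unique) (All.filter⁺ _ L-large) T-range T<L-p)
    where
    T<L-p : length T ℕ.+ k ℕ.< length (without p L)
    T<L-p = ℕ.≤-pred (ℕ.≤-trans T<L (length≤1+length-without p L-unique))

  module Residues (admissible : Admissible h) {T L} (A : Assignment T L) where

    residue : (p : ℕ) → Prime p → ℤ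
    residue p p-prime = lookupOr (pairs A) p (proj₁ (admissible⇒missed-class h admissible p-prime))

    residue-misses : ∀ p p-prime → Misses h p (residue p p-prime)
    residue-misses p p-prime = lookupOr-preserves (Misses h) (pairs A) p _
      (proj₂ (admissible⇒missed-class h admissible p-prime)) (All.map proj₂ (pairs-valid A))

    residue-covers : ∀ {g} → g ∈ T → ¬ g ∈ᵥ h →
                         Σ ℕ λ p → p ∈ L × (∀ p-prime → g ≡ residue p p-prime [mod p ])
    residue-covers {g} g∈T g∉h with p , pg∈ ← covers A g∈T g∉h =
      p , proj₁ (All.lookup (pairs-valid A) pg∈) , λ p-prime →
        subst (λ a → g ≡ a [mod p ])
              (sym (lookupOr-∈ (pairs A) (proj₁ (admissible⇒missed-class h admissible p-prime))
                               (primes-distinct A) pg∈))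
              (≡-refl[mod] g p)

lemma5p1 : (k : ℕ) (h : Vec ℤ k) → Admissible h →
    (S : List ℤ) → Unique S →
    (P : ℕ → Set) → (∀ p → P p → Prime p) →
    (x : ℚ) → ℚ.1ℚ ℚ.+ ℚ.1ℚ ℚ.≤ x →
    (∀ {hᵢ} → hᵢ VecMem.∈ h → hᵢ ∈ S) →
    All (λ s → (ℚ.0ℚ ℚ.≤ toℚ s) × (toℚ s ℚ.≤ x ℚ.* x)) S →
    (Σ (List ℕ) λ L → Unique L × All (λ p → P p × (x ℚ.< toℚ (+ p))) L
        × (length S ℕ.+ k ℕ.< length L)) →
    Σ ((p : ℕ) → P p → ℤ) λ a →
      ∀ (g : ℤ) → (g VecMem.∈ h) ⇔ ((g ∈ S) × (∀ p (pp : P p) → ¬ (g ≡ a p pp [mod p ])))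
lemma5p1 k h admissible S _ P P-prime x 2≤x h⊆S S-range (L , L-unique , L-large , S<L) =
  a , λ g → mk⇔ (λ g∈h → h⊆S g∈h , λ p Pp → residue-misses p (P-prime p Pp) g∈h) (sieved-out g)
  where
  0≤x : ℚ.0ℚ ℚ.≤ x
  0≤x = ℚ.≤-trans (ℚ.<⇒≤ (ℚ.positive⁻¹ _)) 2≤x
  open LargePrimeAssignment h 0≤x (All.lookup S-range ∘ h⊆S)
  assignment : Assignment S L
  assignment =
    assign S L L-unique (All.map (λ (Pp , x<p) → P-prime _ Pp , x<p) L-large) S-range S<L
  open Residues admissible assignment
  a : (p : ℕ) → P p → ℤ
  a p Pp = residue p (P-prime p Pp)
  sieved-out : ∀ g → g ∈ S × (∀ p Pp → ¬ g ≡ a p Pp [mod p ]) → g ∈ᵥ h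
  sieved-out g (g∈S , unsieved) with g ∈ᵥ? h
  ... | yes g∈h = g∈h
  ... | no g∉h with p , p∈L , g≡residue ← residue-covers g∈S g∉h =
    contradiction (g≡residue (P-prime p Pp)) (unsieved p Pp)
    where Pp = proj₁ (All.lookup L-large p∈L)
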